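{- Let $\Gamma$ be a 2-colored best match graph (2-cBMG) with vertex set $V$ in which no two symmetric edges have a common endpoint. Let $\tilde\Gamma$ be a $\dot{\sim}$-consistent underlying oriented digraph of $\Gamma$ with vertices labelled $1,\dots,m$ so that $i<j$ whenever $ij$ is an edge of $\tilde\Gamma$, and let $\ell$ be the unique vertex such that $\ell m$ is a symmetric edge of $\Gamma$. Let $D$ be the set of vertices $d\notin\{\ell,m\}$ with $N(d)=\{m\}$ or $N(d)=\{\ell\}$, and let $\bar\Gamma$ (the truncated graph) be the sub-digraph of $\Gamma$ induced on $\bar V=V\setminus(\{\ell,m\}\cup D)$. Then $\bar\Gamma$ satisfies properties N1, N2 and N3 (with neighbourhoods computed in $\bar\Gamma$), and any two vertices of $\bar\Gamma$ having no out-neighbour in $\bar\Gamma$ are equivalent as vertices of $\Gamma$.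
   Context: Digraphs have no loops or multiple edges; $N(x)$, $N^-(x)$ are out- and in-neighbourhoods, $N(S)=\bigcup_{s\in S}N(s)$. Properties of a bipartite digraph: N1: for any vertices $x,y$ with $x\notin N(y)$, $y\notin N(x)$, $N(x)\cap N(N(y))=N(y)\cap N(N(x))=\emptyset$; N2: $N(N(N(x)))\subseteq N(x)$ for all $x$; N3: for any vertices $x,y$ with $x\notin N(N(y))$, $y\notin N(N(x))$ and $N(x)\cap N(y)\neq\emptyset$, $N^-(x)=N^-(y)$ and $N(x)\subseteq N(y)$ or $N(y)\subseteq N(x)$; N4: every vertex has an out-neighbour. A 2-cBMG is a bipartite digraph (two colour classes, edges joining different classes), not necessarily connected, satisfying N1–N4. Vertices $x,y$ are equivalent ($x\dot\sim y$) if $N(x)=N(y)$, $N^-(x)=N^-(y)$. A symmetric edge is a pair $\{x,y\}$ with both $xy,yx$ edges. An underlying oriented digraph deletes exactly one of $xy,yx$ from each symmetric edge; $\dot\sim$-consistent means for $u\dot\sim u'$, $v\dot\sim v'$, $uv$ is kept iff $u'v'$ is kept. Under these hypotheses $m$ lies on exactly one symmetric edge. -}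

module Defs where

open import Data.Nat using (ℕ; suc)
open import Data.Fin using (Fin; fromℕ; _<_)
open import Data.Bool using (Bool; T)
open import Data.Product using (Σ; ∃; _×_; _,_; proj₁)
open import Data.Sum using (_⊎_)
open import Data.Empty using (⊥)
open import Relation.Nullary using (¬_)
open import Relation.Binary.PropositionalEquality using (_≡_; _≢_)
open import Function.Bundles using (_⇔_)

-- Generic notions for a digraph given by an edge relation E on a type V.
-- N(x) = {y | E x y},  N⁻(x) = {y | E y x}; sets are predicates.

module _ {V : Set} (E : V → V → Set) where

  NN : V → V → Set
  NN x z = ∃ λ w → E x w × E w z

  NNN : V → V → Set
  NNN x z = ∃ λ w → NN x w × E w z

  N1 : Set
  N1 = ∀ x y → ¬ E y x → ¬ E x y →
         (∀ z → E x z → ¬ NN y z) × (∀ z → E y z → ¬ NN x z)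

  N2 : Set
  N2 = ∀ x z → NNN x z → E x z

  N3 : Set
  N3 = ∀ x y → ¬ NN y x → ¬ NN x y → (∃ λ z → E x z × E y z) →
         (∀ z → E z x ⇔ E z y) ×
         ((∀ z → E x z → E y z) ⊎ (∀ z → E y z → E x z))

  N4 : Set
  N4 = ∀ x → ∃ λ y → E x y

  Equiv : V → V → Set
  Equiv x y = (∀ z → E x z ⇔ E y z) × (∀ z → E z x ⇔ E z y)

  Sym : V → V → Set
  Sym x y = E x y × E y x

  NSingleton : V → V → Set
  NSingleton d v = ∀ y → E d y ⇔ (y ≡ v)

  Induced : (P : V → Set) → Σ V P → Σ V P → Set
  Induced P x y = E (proj₁ x) (proj₁ y)

Edge : {k : ℕ} → (Fin k → Fin k → Bool) → Fin k → Fin k → Set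
Edge adj x y = T (adj x y)

Bipartite : {k : ℕ} → (Fin k → Fin k → Bool) → (Fin k → Bool) → Set
Bipartite adj col = ∀ x y → Edge adj x y → col x ≢ col y

Is2cBMG : {k : ℕ} → (Fin k → Fin k → Bool) → (Fin k → Bool) → Set
Is2cBMG adj col =
  Bipartite adj col × N1 (Edge adj) × N2 (Edge adj) × N3 (Edge adj) × N4 (Edge adj)

NoAdjacentSymEdges : {k : ℕ} → (Fin k → Fin k → Bool) → Set
NoAdjacentSymEdges adj =
  ∀ x y z → Sym (Edge adj) x y → Sym (Edge adj) x z → y ≡ z

IsUnderlyingOriented : {k : ℕ} → (adj adj' : Fin k → Fin k → Bool) → Set
IsUnderlyingOriented adj adj' =
  (∀ x y → Edge adj' x y → Edge adj x y) ×
  (∀ x y → Edge adj x y → ¬ Edge adj y x → Edge adj' x y) ×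
  (∀ x y → Sym (Edge adj) x y →
     (Edge adj' x y ⊎ Edge adj' y x) × ¬ (Edge adj' x y × Edge adj' y x))

EquivConsistent : {k : ℕ} → (adj adj' : Fin k → Fin k → Bool) → Set
EquivConsistent adj adj' =
  ∀ u u' v v' → Equiv (Edge adj) u u' → Equiv (Edge adj) v v' →
    Edge adj' u v ⇔ Edge adj' u' v'

TopologicallyLabelled : {k : ℕ} → (Fin k → Fin k → Bool) → Set
TopologicallyLabelled adj' = ∀ i j → Edge adj' i j → i < j

module _ {n : ℕ} (adj : Fin (suc n) → Fin (suc n) → Bool) (ℓ : Fin (suc n)) where

  private
    m : Fin (suc n)
    m = fromℕ n

  InD : Fin (suc n) → Set
  InD d = d ≢ ℓ × d ≢ m ×
          (NSingleton (Edge adj) d m ⊎ NSingleton (Edge adj) d ℓ)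

  InVbar : Fin (suc n) → Set
  InVbar x = x ≢ ℓ × x ≢ m × ¬ InD x

  Ebar : Σ (Fin (suc n)) InVbar → Σ (Fin (suc n)) InVbar → Set
  Ebar = Induced (Edge adj) InVbar

-- Removing the symmetric edge {ℓ, m} together with the set D of vertices
-- pointing only into it leaves a vertex set closed under in-neighbours: the
-- only out-neighbour of m is ℓ (m is last in the topological order, so its
-- out-edges are symmetric) and hence, by N2 and N4, the only out-neighbour of ℓ
-- is m.  Induced subgraphs inherit N1 and N2, and N3 as well once in-neighbours
-- stay inside.  A sink x of the truncated graph points into {ℓ, m}; if two sinks
-- point into the same vertex, each out-neighbour of one is an out-neighbour of
-- the other (otherwise it would survive the truncation), and N3 equates their
-- in-neighbourhoods; if they point into different vertices, N1 forces one of
-- them into D.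
module Submission where

open import Defs
open import Data.Nat using (ℕ; suc)
import Data.Nat.Properties as ℕ
open import Data.Fin using (Fin; fromℕ; _≟_)
open import Data.Fin.Properties using (≤fromℕ)
open import Data.Bool using (Bool; not; T?)
open import Data.Bool.Properties using (¬-not; not-involutive)
open import Data.Product using (Σ; _×_; _,_; proj₁; proj₂)
open import Data.Sum using (_⊎_; inj₁; inj₂)
open import Data.Empty using (⊥-elim)
open import Relation.Nullary using (¬_; yes; no)
open import Relation.Binary.Definitions using (Decidable; DecidableEquality)
open import Relation.Binary.PropositionalEquality using (_≡_; refl; _≢_; cong; module ≡-Reasoning)
open import Function.Bundles using (_⇔_; mk⇔; Equivalence)

module _ {V : Set} (E : V → V → Set) where

  PredecessorClosed : (V → Set) → Set
  PredecessorClosed P = ∀ {w x} → E w x → P x → P w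

  Truncation : V → V → V → Set
  Truncation a b x = x ≢ a × x ≢ b × ¬ NSingleton E x a × ¬ NSingleton E x b

  SinkIn : (P : V → Set) → Σ V P → Set
  SinkIn P x = ∀ z → ¬ Induced E P x z

module DigraphProperties {V : Set} (E : V → V → Set) where

  NSingleton-edge : ∀ {d v} → NSingleton E d v → E d v
  NSingleton-edge {v = v} ns = Equivalence.from (ns v) refl

  NSingleton-unique : ∀ {d v y} → NSingleton E d v → E d y → y ≡ v
  NSingleton-unique {y = y} ns = Equivalence.to (ns y)

  Truncation-swap : ∀ {a b x} → Truncation E a b x → Truncation E b a x
  Truncation-swap (x≢a , x≢b , ¬a , ¬b) = x≢b , x≢a , ¬b , ¬a

  Truncation-predecessorClosed : ∀ {a b} → (∀ t → E a t → t ≡ b) → (∀ t → E b t → t ≡ a) →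
                                 PredecessorClosed E (Truncation E a b)
  Truncation-predecessorClosed out-a out-b wx (x≢a , x≢b , _ , _) =
    (λ { refl → x≢b (out-a _ wx) }) ,
    (λ { refl → x≢a (out-b _ wx) }) ,
    (λ ns → x≢a (NSingleton-unique ns wx)) ,
    (λ ns → x≢b (NSingleton-unique ns wx))

  N1-induced : ∀ {P} → N1 E → N1 (Induced E P)
  N1-induced n1 (x , _) (y , _) ¬yx ¬xy =
    (λ { (z , _) xz ((w , _) , yw , wz) → proj₁ (n1 x y ¬yx ¬xy) z xz (w , yw , wz) }) ,
    (λ { (z , _) yz ((w , _) , xw , wz) → proj₂ (n1 x y ¬yx ¬xy) z yz (w , xw , wz) })

  N2-induced : ∀ {P} → N2 E → N2 (Induced E P)
  N2-induced n2 (x , _) (z , _) ((w , _) , ((v , _) , xv , vw) , wz) =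
    n2 x z (w , (v , xv , vw) , wz)

  ¬NN-lift : ∀ {P} → PredecessorClosed E P → ∀ (x y : Σ V P) →
             ¬ NN (Induced E P) y x → ¬ NN E (proj₁ y) (proj₁ x)
  ¬NN-lift closed (_ , px) _ ¬yx (w , yw , wx) = ¬yx ((w , closed wx px) , yw , wx)

  N3-induced : ∀ {P} → PredecessorClosed E P → N3 E → N3 (Induced E P)
  N3-induced closed n3 x y ¬yx ¬xy ((z , _) , xz , yz)
    with n3 (proj₁ x) (proj₁ y) (¬NN-lift closed x y ¬yx) (¬NN-lift closed y x ¬xy) (z , xz , yz)
  ... | in⇔ , inj₁ x⊆y = (λ w → in⇔ (proj₁ w)) , inj₁ (λ w → x⊆y (proj₁ w))
  ... | in⇔ , inj₂ y⊆x = (λ w → in⇔ (proj₁ w)) , inj₂ (λ w → y⊆x (proj₁ w))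

  partner-out-unique : N2 E → N4 E → (∀ x y z → Sym E x y → Sym E x z → y ≡ z) →
                       ∀ {a b} → Sym E a b → (∀ t → E b t → t ≡ a) → ∀ x → E a x → x ≡ b
  partner-out-unique n2 n4 noAdj {a} {b} (ab , ba) out-b x ax with n4 x
  ... | t , xt = noAdj a x b (ax , xa) (ab , ba)
    where
      xa : E x a
      xa with out-b t (n2 b t (x , (a , ba , ax) , xt))
      ... | refl = xt

module TruncationSinks
    {V : Set} {E : V → V → Set} (_≟ᵥ_ : DecidableEquality V) (E? : Decidable E)
    (no-triangle : ∀ {x y z} → E x y → E y z → ¬ E x z)
    (n1 : N1 E) (n2 : N2 E) (n3 : N3 E) (n4 : N4 E)
    {Kept : V → Set} (closed : PredecessorClosed E Kept) where

  open DigraphProperties E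

  Sink : Σ V Kept → Set
  Sink = SinkIn E Kept

  module Ordered {a b : V} (ab : E a b) (ba : E b a) (kept⇔ : ∀ x → Kept x ⇔ Truncation E a b x) where

    kept : ∀ {z} → z ≢ a → z ≢ b → ¬ NSingleton E z a → ¬ NSingleton E z b → Kept z
    kept z≢a z≢b ¬a ¬b = Equivalence.from (kept⇔ _) (z≢a , z≢b , ¬a , ¬b)

    sink-into-pair : ∀ x → Sink x → E (proj₁ x) a ⊎ E (proj₁ x) b
    sink-into-pair (x , _) sink with n4 x
    ... | w , xw with w ≟ᵥ a | w ≟ᵥ b | E? w b | E? w a
    ... | yes refl | _ | _ | _ = inj₁ xw
    ... | no _ | yes refl | _ | _ = inj₂ xw
    ... | no _ | no _ | yes wb | _ = inj₁ (n2 x a (b , (w , xw , wb) , ba))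
    ... | no _ | no _ | no _ | yes wa = inj₂ (n2 x b (a , (w , xw , wa) , ab))
    ... | no w≢a | no w≢b | no ¬wb | no ¬wa =
      ⊥-elim (sink (w , kept w≢a w≢b (λ ns → ¬wa (NSingleton-edge ns)) (λ ns → ¬wb (NSingleton-edge ns))) xw)

    sink-out-⊆ : ∀ x y → Sink x → Sink y → E (proj₁ x) a → E (proj₁ y) a →
                 ∀ z → E (proj₁ x) z → E (proj₁ y) z
    sink-out-⊆ (x , _) (y , ky) sink _ xa ya z xz with E? y z
    ... | yes yz = yz
    ... | no ¬yz = ⊥-elim (sink (z , kept z≢a z≢b ¬a ¬b) xz)
      where
        y≢b : y ≢ b
        y≢b = proj₁ (proj₂ (Equivalence.to (kept⇔ y) ky))
        z≢a : z ≢ a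
        z≢a refl = ¬yz ya
        z≢b : z ≢ b
        z≢b refl = no-triangle xa ab xz
        ¬a : ¬ NSingleton E z a
        ¬a ns = no-triangle xz (NSingleton-edge ns) xa
        ¬b : ¬ NSingleton E z b
        ¬b ns = proj₂ (n1 y z (λ zy → y≢b (NSingleton-unique ns zy)) ¬yz) b
                  (NSingleton-edge ns) (a , ya , ab)

    sinks-same-side-equiv : ∀ x y → Sink x → Sink y → E (proj₁ x) a → E (proj₁ y) a →
                            Equiv E (proj₁ x) (proj₁ y)
    sinks-same-side-equiv x y sx sy xa ya =
      (λ z → mk⇔ (sink-out-⊆ x y sx sy xa ya z) (sink-out-⊆ y x sy sx ya xa z)) ,
      proj₁ (n3 (proj₁ x) (proj₁ y) (¬NN-lift closed x y ¬NN-yx) (¬NN-lift closed y x ¬NN-xy)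
                (a , xa , ya))
      where
        ¬NN-yx : ¬ NN (Induced E Kept) y x
        ¬NN-yx (w , yw , _) = sy w yw
        ¬NN-xy : ¬ NN (Induced E Kept) x y
        ¬NN-xy (w , xw , _) = sx w xw

    -- The second sink would have N(y) = {b}, i.e. lie in D.
    sinks-opposite-sides : ∀ x y → Sink x → Sink y → E (proj₁ x) a → ¬ E (proj₁ y) b
    sinks-opposite-sides x@(x₀ , _) y@(y₀ , ky) sx sy xa yb =
      proj₂ (proj₂ (proj₂ (Equivalence.to (kept⇔ y₀) ky))) (λ t → mk⇔ (only-b t) λ { refl → yb })
      where
        only-b : ∀ t → E y₀ t → t ≡ b
        only-b t yt with t ≟ᵥ b
        ... | yes t≡b = t≡b
        ... | no t≢b = ⊥-elim (sy (t , kept t≢a t≢b ¬a ¬b) yt)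
          where
            t≢a : t ≢ a
            t≢a refl = no-triangle yb ba yt
            ¬a : ¬ NSingleton E t a
            ¬a ns = proj₁ (n1 x₀ y₀ (sy x) (sx y)) a xa (t , yt , NSingleton-edge ns)
            ¬b : ¬ NSingleton E t b
            ¬b ns = no-triangle yt (NSingleton-edge ns) yb

  Truncation⇔-swap : ∀ {a b} → (∀ x → Kept x ⇔ Truncation E a b x) → ∀ x → Kept x ⇔ Truncation E b a x
  Truncation⇔-swap kept⇔ x =
    mk⇔ (λ k → Truncation-swap (Equivalence.to (kept⇔ x) k))
        (λ t → Equivalence.from (kept⇔ x) (Truncation-swap t))

  sinks-equiv : ∀ {a b} → Sym E a b → (∀ x → Kept x ⇔ Truncation E a b x) →
                ∀ x y → Sink x → Sink y → Equiv E (proj₁ x) (proj₁ y)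
  sinks-equiv {a} {b} (ab , ba) kept⇔ x y sx sy =
    by-sides (AB.sink-into-pair x sx) (AB.sink-into-pair y sy)
    where
      module AB = Ordered ab ba kept⇔
      module BA = Ordered ba ab (Truncation⇔-swap kept⇔)

      by-sides : E (proj₁ x) a ⊎ E (proj₁ x) b → E (proj₁ y) a ⊎ E (proj₁ y) b →
                 Equiv E (proj₁ x) (proj₁ y)
      by-sides (inj₁ xa) (inj₁ ya) = AB.sinks-same-side-equiv x y sx sy xa ya
      by-sides (inj₂ xb) (inj₂ yb) = BA.sinks-same-side-equiv x y sx sy xb yb
      by-sides (inj₁ xa) (inj₂ yb) = ⊥-elim (AB.sinks-opposite-sides x y sx sy xa yb)
      by-sides (inj₂ xb) (inj₁ ya) = ⊥-elim (BA.sinks-opposite-sides x y sx sy xb ya)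

Bipartite-no-triangle : ∀ {k} {adj : Fin k → Fin k → Bool} {col : Fin k → Bool} → Bipartite adj col →
                        ∀ {x y z} → Edge adj x y → Edge adj y z → ¬ Edge adj x z
Bipartite-no-triangle {col = col} bip {x} {y} {z} xy yz xz = bip x z xz (begin
  col x             ≡⟨ ¬-not (bip x y xy) ⟩
  not (col y)       ≡⟨ cong not (¬-not (bip y z yz)) ⟩
  not (not (col z)) ≡⟨ not-involutive (col z) ⟩
  col z             ∎)
  where open ≡-Reasoning

last-out-symmetric : ∀ {n} {adj adj' : Fin (suc n) → Fin (suc n) → Bool} →
                     IsUnderlyingOriented adj adj' → TopologicallyLabelled adj' →
                     ∀ t → Edge adj (fromℕ n) t → Edge adj t (fromℕ n)
last-out-symmetric {n} {adj} (_ , keep-asym , _) top t mt with T? (adj t (fromℕ n))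
... | yes tm = tm
... | no ¬tm = ⊥-elim (ℕ.≤⇒≯ (≤fromℕ t) (top (fromℕ n) t (keep-asym (fromℕ n) t mt ¬tm)))

InVbar⇔Truncation : ∀ {n} (adj : Fin (suc n) → Fin (suc n) → Bool) ℓ x →
                    InVbar adj ℓ x ⇔ Truncation (Edge adj) ℓ (fromℕ n) x
InVbar⇔Truncation adj ℓ x = mk⇔
  (λ (x≢ℓ , x≢m , ¬d) → x≢ℓ , x≢m , (λ ns → ¬d (x≢ℓ , x≢m , inj₂ ns)) , (λ ns → ¬d (x≢ℓ , x≢m , inj₁ ns)))
  (λ (x≢ℓ , x≢m , ¬ℓ , ¬m) → x≢ℓ , x≢m , λ { (_ , _ , inj₁ ns) → ¬m ns ; (_ , _ , inj₂ ns) → ¬ℓ ns })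

proposition7 : (n : ℕ) (adj : Fin (suc n) → Fin (suc n) → Bool) (col : Fin (suc n) → Bool)
    → Is2cBMG adj col
    → NoAdjacentSymEdges adj
    → (adj' : Fin (suc n) → Fin (suc n) → Bool)
    → IsUnderlyingOriented adj adj'
    → EquivConsistent adj adj'
    → TopologicallyLabelled adj'
    → (ℓ : Fin (suc n))
    → Sym (Edge adj) ℓ (fromℕ n)
    → N1 (Ebar adj ℓ) × N2 (Ebar adj ℓ) × N3 (Ebar adj ℓ)
      × (∀ x y → (∀ z → ¬ Ebar adj ℓ x z) → (∀ z → ¬ Ebar adj ℓ y z)
           → Equiv (Edge adj) (proj₁ x) (proj₁ y))
proposition7 n adj col (bip , n1 , n2 , n3 , n4) noAdj adj' oriented _ top ℓ ℓ⇄m@(ℓm , mℓ) =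
  N1-induced n1 , N2-induced n2 , N3-induced closed n3 ,
  TruncationSinks.sinks-equiv _≟_ (λ x y → T? (adj x y)) (Bipartite-no-triangle bip) n1 n2 n3 n4
    closed ℓ⇄m (InVbar⇔Truncation adj ℓ)
  where
    open DigraphProperties (Edge adj)

    out-m : ∀ t → Edge adj (fromℕ n) t → t ≡ ℓ
    out-m t mt = noAdj (fromℕ n) t ℓ (mt , last-out-symmetric oriented top t mt) (mℓ , ℓm)

    out-ℓ : ∀ t → Edge adj ℓ t → t ≡ fromℕ n
    out-ℓ = partner-out-unique n2 n4 noAdj ℓ⇄m out-m

    closed : PredecessorClosed (Edge adj) (InVbar adj ℓ)
    closed wx kx = Equivalence.from (InVbar⇔Truncation adj ℓ _)
      (Truncation-predecessorClosed out-ℓ out-m wx (Equivalence.to (InVbar⇔Truncation adj ℓ _) kx))
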